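{- Let $r\ge2$ and $n\ge 1$. With $T_{n,\ell}^{(r)}$ the number of paths in $\mathcal{A}_{n,0}^{(r)}$ containing exactly $\ell$ occurrences of $\mathbf{udu}$ and $S_n^{(r)}=|\mathcal{A}_{n,0}^{(r)}|$, $$\sum_{\ell=1}^{n}\ell\,T_{n+1,\ell}^{(r)}=rnS_n^{(r)}.$$
   Context: A Dyck path of length $2n$ is a lattice path from $(0,0)$ to $(2n,0)$ weakly above the $x$-axis with steps $\mathbf{u}=(1,1)$, $\mathbf{d}=(1,-1)$; an $r$-colored Dyck path has each $\mathbf{d}$-step colored with one of $r$ colors. $\mathcal{A}_{n,0}^{(r)}$ is the set of $r$-colored Dyck paths of length $2n$ with no two consecutive $\mathbf{d}$-steps of the same color. An occurrence of $\mathbf{udu}$ is a triple of consecutive steps of the form $\mathbf{u},\mathbf{d},\mathbf{u}$ (colors ignored); occurrences may overlap. -}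

module Defs where

open import Data.Nat using (ℕ; zero; suc; _+_; _*_) renaming (_≟_ to _≟ⁿ_)
open import Data.Fin using (Fin)
open import Data.Fin.Properties using () renaming (_≟_ to _≟ᶠ_)
open import Data.List using (List; []; _∷_; map; concatMap; length; filter; sum; allFin)
open import Data.Bool using (Bool; true; false; _∧_; not) renaming (_≟_ to _≟ᵇ_)
open import Relation.Nullary.Decidable using (⌊_⌋)
open import Relation.Binary.PropositionalEquality using (_≡_)

data Step (r : ℕ) : Set where
  U : Step r
  D : Fin r → Step r

words : (r k : ℕ) → List (List (Step r))
words r zero    = [] ∷ []
words r (suc k) = concatMap (λ w → (U ∷ w) ∷ map (λ c → D c ∷ w) (allFin r)) (words r k)

dyckFrom : {r : ℕ} → ℕ → List (Step r) → Bool
dyckFrom zero    []           = true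
dyckFrom (suc _) []           = false
dyckFrom h       (U ∷ w)      = dyckFrom (suc h) w
dyckFrom zero    (D _ ∷ w)    = false
dyckFrom (suc h) (D _ ∷ w)    = dyckFrom h w

isDyck : {r : ℕ} → List (Step r) → Bool
isDyck = dyckFrom 0

noSameDD : {r : ℕ} → List (Step r) → Bool
noSameDD []                    = true
noSameDD (_ ∷ [])              = true
noSameDD (U ∷ w)               = noSameDD w
noSameDD (D a ∷ U ∷ w)         = noSameDD (U ∷ w)
noSameDD (D a ∷ D b ∷ w)       = not ⌊ a ≟ᶠ b ⌋ ∧ noSameDD (D b ∷ w)

inA : {r : ℕ} → List (Step r) → Bool
inA w = isDyck w ∧ noSameDD w

A : (r n : ℕ) → List (List (Step r))
A r n = filter (λ w → inA w ≟ᵇ true) (words r (2 * n))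

-- Number of (possibly overlapping) occurrences of u d u, colors ignored.
countUDU : {r : ℕ} → List (Step r) → ℕ
countUDU (U ∷ D _ ∷ U ∷ w) = suc (countUDU (U ∷ w))
countUDU []                = 0
countUDU (_ ∷ w)           = countUDU w

S : (r n : ℕ) → ℕ
S r n = length (A r n)

T : (r n ℓ : ℕ) → ℕ
T r n ℓ = length (filter (λ w → countUDU w ≟ⁿ ℓ) (A r n))

sumFrom1 : ℕ → (ℕ → ℕ) → ℕ
sumFrom1 zero    f = 0
sumFrom1 (suc m) f = sumFrom1 m f + f (suc m)

-- Marked occurrences of u d u in paths of A_{n+1,0} are in bijection with triples
-- (path of A_{n,0}, one of its n up steps, a colour c): insert d_c u right after the
-- chosen up step.  The inserted d_c sits between two up steps, so it cannot clash with
-- another down step, and the height profile is unchanged outside the new peak; hence the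
-- insertion preserves membership in A, and every occurrence of u d u arises exactly once.
module Submission where

open import Defs
open import Data.Nat using (ℕ; zero; suc; _+_; _*_; _≤_; _<_; z≤n; s≤s) renaming (_≟_ to _≟ⁿ_)
open import Data.Nat.Properties
open import Data.Nat.Tactic.RingSolver using (solve-∀)
open import Algebra.Properties.CommutativeSemigroup +-commutativeSemigroup using (interchange)
open import Data.List using (List; []; _∷_; _++_; map; concatMap; length; filter; allFin)
open import Data.List.Properties using (length-++; length-map; length-tabulate)
open import Data.List.Relation.Unary.All as All using (All; []; _∷_)
open import Data.List.Relation.Unary.All.Properties using (++⁺; map⁺; concat⁺; tabulate⁺; filter⁺)
open import Data.Bool using (Bool; true; false; _∧_) renaming (_≟_ to _≟ᵇ_)
open import Relation.Nullary using (does; yes; no)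
open import Relation.Nullary.Decidable using (dec-true; dec-false)
open import Relation.Unary using (Pred; Decidable)
open import Relation.Binary.PropositionalEquality
open import Level using (Level)
open import Function using (_∘_; id)
open ≡-Reasoning

private
  variable
    a : Level
    X Y : Set
    r : ℕ

∑ : List X → (X → ℕ) → ℕ
∑ []       f = 0
∑ (x ∷ xs) f = f x + ∑ xs f

infix 6.5 ∑
syntax ∑ xs (λ x → e) = ∑[ x ∈ xs ] e

𝟙 : Bool → ℕ
𝟙 true  = 1
𝟙 false = 0

∑-congᴬ : {f g : X → ℕ} {xs : List X} → All (λ x → f x ≡ g x) xs → ∑ xs f ≡ ∑ xs g
∑-congᴬ []       = refl
∑-congᴬ (e ∷ es) = cong₂ _+_ e (∑-congᴬ es)

∑-cong : {f g : X → ℕ} (xs : List X) → (∀ x → f x ≡ g x) → ∑ xs f ≡ ∑ xs g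
∑-cong xs e = ∑-congᴬ (All.universal e xs)

∑-zero : (xs : List X) → ∑[ _ ∈ xs ] 0 ≡ 0
∑-zero []       = refl
∑-zero (_ ∷ xs) = ∑-zero xs

∑-const : (m : ℕ) (xs : List X) → ∑[ _ ∈ xs ] m ≡ length xs * m
∑-const m []       = refl
∑-const m (_ ∷ xs) = cong (m +_) (∑-const m xs)

∑-+ : {f g : X → ℕ} (xs : List X) → ∑[ x ∈ xs ] (f x + g x) ≡ ∑ xs f + ∑ xs g
∑-+ []                     = refl
∑-+ {f = f} {g} (x ∷ xs) =
  trans (cong (f x + g x +_) (∑-+ xs)) (interchange (f x) (g x) (∑ xs f) (∑ xs g))

∑-*ˡ : {f : X → ℕ} (m : ℕ) (xs : List X) → ∑[ x ∈ xs ] m * f x ≡ m * ∑ xs f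
∑-*ˡ m []                 = sym (*-zeroʳ m)
∑-*ˡ {f = f} m (x ∷ xs) = trans (cong (m * f x +_) (∑-*ˡ m xs)) (sym (*-distribˡ-+ m (f x) _))

∑-++ : {f : X → ℕ} (xs ys : List X) → ∑ (xs ++ ys) f ≡ ∑ xs f + ∑ ys f
∑-++ []                    ys = refl
∑-++ {f = f} (x ∷ xs) ys = trans (cong (f x +_) (∑-++ xs ys)) (sym (+-assoc (f x) _ _))

∑-map : {f : Y → ℕ} (h : X → Y) (xs : List X) → ∑ (map h xs) f ≡ ∑ xs (f ∘ h)
∑-map h []                 = refl
∑-map {f = f} h (x ∷ xs) = cong (f (h x) +_) (∑-map h xs)

∑-concatMap : {f : Y → ℕ} (h : X → List Y) (xs : List X) →
  ∑ (concatMap h xs) f ≡ ∑[ x ∈ xs ] ∑ (h x) f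
∑-concatMap h []                 = refl
∑-concatMap {f = f} h (x ∷ xs) =
  trans (∑-++ (h x) _) (cong (∑ (h x) f +_) (∑-concatMap h xs))

∑-comm : (f : X → Y → ℕ) (xs : List X) (ys : List Y) →
  ∑[ x ∈ xs ] ∑ ys (f x) ≡ ∑[ y ∈ ys ] ∑[ x ∈ xs ] f x y
∑-comm f []       ys = sym (∑-zero ys)
∑-comm f (x ∷ xs) ys = trans (cong (∑ ys (f x) +_) (∑-comm f xs ys)) (sym (∑-+ ys))

length-filter≡∑ : {P : Pred X a} (P? : Decidable P) (xs : List X) →
  length (filter P? xs) ≡ ∑[ x ∈ xs ] 𝟙 (does (P? x))
length-filter≡∑ P? []       = refl
length-filter≡∑ P? (x ∷ xs) with does (P? x)
... | true  = cong suc (length-filter≡∑ P? xs)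
... | false = length-filter≡∑ P? xs

∑-filter : {P : Pred X a} {f : X → ℕ} (P? : Decidable P) (xs : List X) →
  ∑ (filter P? xs) f ≡ ∑[ x ∈ xs ] 𝟙 (does (P? x)) * f x
∑-filter P? []                 = refl
∑-filter {f = f} P? (x ∷ xs) with does (P? x)
... | true  = cong₂ _+_ (sym (+-identityʳ (f x))) (∑-filter P? xs)
... | false = ∑-filter P? xs

𝟙-does-≟-true : (b : Bool) → 𝟙 (does (b ≟ᵇ true)) ≡ 𝟙 b
𝟙-does-≟-true true  = refl
𝟙-does-≟-true false = refl

sumFrom1-cong : (n : ℕ) {f g : ℕ → ℕ} → (∀ ℓ → f ℓ ≡ g ℓ) → sumFrom1 n f ≡ sumFrom1 n g
sumFrom1-cong zero    e = refl
sumFrom1-cong (suc n) e = cong₂ _+_ (sumFrom1-cong n e) (e (suc n))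

sumFrom1-∑ : (n : ℕ) (g : ℕ → X → ℕ) (xs : List X) →
  sumFrom1 n (λ ℓ → ∑ xs (g ℓ)) ≡ ∑[ x ∈ xs ] sumFrom1 n (λ ℓ → g ℓ x)
sumFrom1-∑ zero    g xs = sym (∑-zero xs)
sumFrom1-∑ (suc n) g xs =
  trans (cong (_+ ∑ xs (g (suc n))) (sumFrom1-∑ n g xs)) (sym (∑-+ xs))

𝟙-≟-≢ : {x ℓ : ℕ} → x ≢ ℓ → ℓ * 𝟙 (does (x ≟ⁿ ℓ)) ≡ 0
𝟙-≟-≢ {x} {ℓ} x≢ℓ = trans (cong (λ b → ℓ * 𝟙 b) (dec-false (x ≟ⁿ ℓ) x≢ℓ)) (*-zeroʳ ℓ)

𝟙-≟-refl : (ℓ : ℕ) → ℓ * 𝟙 (does (ℓ ≟ⁿ ℓ)) ≡ ℓ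
𝟙-≟-refl ℓ = trans (cong (λ b → ℓ * 𝟙 b) (dec-true (ℓ ≟ⁿ ℓ) refl)) (*-identityʳ ℓ)

sumFrom1-indicator-beyond : (n x : ℕ) → n < x → sumFrom1 n (λ ℓ → ℓ * 𝟙 (does (x ≟ⁿ ℓ))) ≡ 0
sumFrom1-indicator-beyond zero    x n<x = refl
sumFrom1-indicator-beyond (suc n) x n<x =
  cong₂ _+_ (sumFrom1-indicator-beyond n x (<-trans (n<1+n n) n<x))
            (𝟙-≟-≢ (λ x≡ → <-irrefl (sym x≡) n<x))

sumFrom1-indicator : (n x : ℕ) → x ≤ n → sumFrom1 n (λ ℓ → ℓ * 𝟙 (does (x ≟ⁿ ℓ))) ≡ x
sumFrom1-indicator zero    x z≤n = refl
sumFrom1-indicator (suc n) x x≤n with x ≟ⁿ suc n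
... | yes refl = cong₂ _+_ (sumFrom1-indicator-beyond n (suc n) (n<1+n n)) (𝟙-≟-refl (suc n))
... | no x≢n   = trans (cong₂ _+_ (sumFrom1-indicator n x (m<1+n⇒m≤n (≤∧≢⇒< x≤n x≢n))) (𝟙-≟-≢ x≢n))
                       (+-identityʳ x)

sumFrom1-fibres : (n : ℕ) (f : X → ℕ) (xs : List X) → All (λ x → f x ≤ n) xs →
  sumFrom1 n (λ ℓ → ℓ * length (filter (λ x → f x ≟ⁿ ℓ) xs)) ≡ ∑ xs f
sumFrom1-fibres n f xs bounded = begin
  sumFrom1 n (λ ℓ → ℓ * length (filter (λ x → f x ≟ⁿ ℓ) xs))
    ≡⟨ sumFrom1-cong n (λ ℓ → trans (cong (ℓ *_) (length-filter≡∑ (λ x → f x ≟ⁿ ℓ) xs))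
                                    (sym (∑-*ˡ ℓ xs))) ⟩
  sumFrom1 n (λ ℓ → ∑[ x ∈ xs ] ℓ * 𝟙 (does (f x ≟ⁿ ℓ)))
    ≡⟨ sumFrom1-∑ n (λ ℓ x → ℓ * 𝟙 (does (f x ≟ⁿ ℓ))) xs ⟩
  ∑[ x ∈ xs ] sumFrom1 n (λ ℓ → ℓ * 𝟙 (does (f x ≟ⁿ ℓ)))
    ≡⟨ ∑-congᴬ (All.map (λ {x} → sumFrom1-indicator n (f x)) bounded) ⟩
  ∑ xs f ∎

words-length : (k : ℕ) → All (λ w → length w ≡ k) (words r k)
words-length zero    = refl ∷ []
words-length (suc k) =
  concat⁺ (map⁺ (All.map (λ l → cong suc l ∷ map⁺ (tabulate⁺ (λ _ → cong suc l))) (words-length k)))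

∑-words-suc : (k : ℕ) (f : List (Step r) → ℕ) →
  ∑ (words r (suc k)) f ≡
  ∑[ w ∈ words r k ] f (U ∷ w) + ∑[ c ∈ allFin r ] ∑[ w ∈ words r k ] f (D c ∷ w)
∑-words-suc {r} k f = begin
  ∑ (words r (suc k)) f
    ≡⟨ ∑-concatMap _ (words r k) ⟩
  ∑[ w ∈ words r k ] (f (U ∷ w) + ∑ (map (λ c → D c ∷ w) (allFin r)) f)
    ≡⟨ ∑-cong (words r k) (λ w → cong (f (U ∷ w) +_) (∑-map (λ c → D c ∷ w) (allFin r))) ⟩
  ∑[ w ∈ words r k ] (f (U ∷ w) + ∑[ c ∈ allFin r ] f (D c ∷ w))
    ≡⟨ ∑-+ (words r k) ⟩
  ∑[ w ∈ words r k ] f (U ∷ w) + ∑[ w ∈ words r k ] ∑[ c ∈ allFin r ] f (D c ∷ w)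
    ≡⟨ cong₂ _+_ refl (∑-comm (λ w c → f (D c ∷ w)) (words r k) (allFin r)) ⟩
  ∑[ w ∈ words r k ] f (U ∷ w) + ∑[ c ∈ allFin r ] ∑[ w ∈ words r k ] f (D c ∷ w) ∎

ups : List (Step r) → ℕ
ups []        = 0
ups (U ∷ w)   = suc (ups w)
ups (D _ ∷ w) = ups w

dyckFrom-U∷ : (h : ℕ) (w : List (Step r)) → dyckFrom h (U ∷ w) ≡ dyckFrom (suc h) w
dyckFrom-U∷ zero    w = refl
dyckFrom-U∷ (suc h) w = refl

dyckFrom-length : (h : ℕ) (w : List (Step r)) → dyckFrom h w ≡ true → length w ≡ h + 2 * ups w
dyckFrom-length zero    []        _ = refl
dyckFrom-length h       (U ∷ w)   d =
  trans (cong suc (dyckFrom-length (suc h) w (trans (sym (dyckFrom-U∷ h w)) d))) (arith h (ups w))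
  where
  arith : ∀ h u → suc (suc h + 2 * u) ≡ h + 2 * suc u
  arith = solve-∀
dyckFrom-length (suc h) (D _ ∷ w) d = cong suc (dyckFrom-length h w d)

ups-weighted : (n : ℕ) (w : List (Step r)) → length w ≡ 2 * n →
  ups w * 𝟙 (inA w) ≡ n * 𝟙 (inA w)
ups-weighted n w l with isDyck w in dyck
... | true  = cong (_* _) (*-cancelˡ-≡ (ups w) n 2 (trans (sym (dyckFrom-length 0 w dyck)) l))
... | false = trans (*-zeroʳ (ups w)) (sym (*-zeroʳ n))

beginsDU : List (Step r) → ℕ
beginsDU (D _ ∷ U ∷ _) = 1
beginsDU _             = 0

countUDU-U∷ : (v : List (Step r)) → countUDU (U ∷ v) ≡ beginsDU v + countUDU v
countUDU-U∷ []              = refl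
countUDU-U∷ (U ∷ _)         = refl
countUDU-U∷ (D _ ∷ [])      = refl
countUDU-U∷ (D _ ∷ U ∷ _)   = refl
countUDU-U∷ (D _ ∷ D _ ∷ _) = refl

∑-words-beginsDU : (k : ℕ) (f : List (Step r) → ℕ) →
  ∑[ v ∈ words r (2 + k) ] beginsDU v * f v ≡ ∑[ c ∈ allFin r ] ∑[ w ∈ words r k ] f (D c ∷ U ∷ w)
∑-words-beginsDU {r} k f = begin
  ∑[ v ∈ words r (2 + k) ] beginsDU v * f v
    ≡⟨ ∑-words-suc (suc k) _ ⟩
  ∑[ v ∈ words r (suc k) ] 0 + ∑[ c ∈ allFin r ] ∑[ v ∈ words r (suc k) ] beginsDU (D c ∷ v) * f (D c ∷ v)
    ≡⟨ cong₂ _+_ (∑-zero (words r (suc k))) (∑-cong (allFin r) (λ c → ∑-words-suc k _)) ⟩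
  ∑[ c ∈ allFin r ] (∑[ w ∈ words r k ] 1 * f (D c ∷ U ∷ w) + ∑[ _ ∈ allFin r ] ∑[ _ ∈ words r k ] 0)
    ≡⟨ ∑-cong (allFin r) (λ c → cong₂ _+_ (∑-cong (words r k) (λ w → *-identityˡ _))
                                          (∑-cong (allFin r) (λ _ → ∑-zero (words r k)))) ⟩
  ∑[ c ∈ allFin r ] (∑[ w ∈ words r k ] f (D c ∷ U ∷ w) + ∑[ _ ∈ allFin r ] 0)
    ≡⟨ ∑-cong (allFin r) (λ c → trans (cong₂ _+_ refl (∑-zero (allFin r))) (+-identityʳ _)) ⟩
  ∑[ c ∈ allFin r ] ∑[ w ∈ words r k ] f (D c ∷ U ∷ w) ∎

2*countUDU-≤ : (x : Step r) (w : List (Step r)) → 2 * countUDU (x ∷ w) ≤ length w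
2*countUDU-≤ U     []              = z≤n
2*countUDU-≤ U     (U ∷ w)         = m≤n⇒m≤1+n (2*countUDU-≤ U w)
2*countUDU-≤ U     (D _ ∷ [])      = z≤n
2*countUDU-≤ U     (D _ ∷ U ∷ w)   =
  ≤-trans (≤-reflexive (*-suc 2 (countUDU (U ∷ w)))) (s≤s (s≤s (2*countUDU-≤ U w)))
2*countUDU-≤ U     (D c ∷ D d ∷ w) = m≤n⇒m≤1+n (2*countUDU-≤ (D c) (D d ∷ w))
2*countUDU-≤ (D _) []              = z≤n
2*countUDU-≤ (D _) (y ∷ w)         = m≤n⇒m≤1+n (2*countUDU-≤ y w)

countUDU-≤ : (n : ℕ) (v : List (Step r)) → length v ≡ 2 + 2 * n → countUDU v ≤ n
countUDU-≤ n (x ∷ w) l = m<1+n⇒m≤n (*-cancelˡ-< 2 (countUDU (x ∷ w)) (suc n) 2c<2[1+n])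
  where
  2c<2[1+n] : 2 * countUDU (x ∷ w) < 2 * suc n
  2c<2[1+n] = ≤-<-trans (2*countUDU-≤ x w)
                        (subst (_< 2 * suc n) (sym (suc-injective l)) (≤-reflexive (sym (*-suc 2 n))))

insertions : List (Step r) → List (List (Step r))
insertions         []        = []
insertions {r = r} (U ∷ w)   = map (λ c → U ∷ D c ∷ U ∷ w) (allFin r) ++ map (U ∷_) (insertions w)
insertions         (D c ∷ w) = map (D c ∷_) (insertions w)

data _⇝_ {r : ℕ} : List (Step r) → List (Step r) → Set where
  here  : ∀ c w → (U ∷ w) ⇝ (U ∷ D c ∷ U ∷ w)
  there : ∀ x {w v} → w ⇝ v → (x ∷ w) ⇝ (x ∷ v)

insertions-⇝ : (w : List (Step r)) → All (w ⇝_) (insertions w)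
insertions-⇝ []        = []
insertions-⇝ (U ∷ w)   =
  ++⁺ (map⁺ (tabulate⁺ (λ c → here c w))) (map⁺ (All.map (there U) (insertions-⇝ w)))
insertions-⇝ (D c ∷ w) = map⁺ (All.map (there (D c)) (insertions-⇝ w))

length-insertions : (w : List (Step r)) → length (insertions w) ≡ r * ups w
length-insertions {r} []      = sym (*-zeroʳ r)
length-insertions {r} (U ∷ w) = begin
  length (map _ (allFin r) ++ map (U ∷_) (insertions w))
    ≡⟨ length-++ (map _ (allFin r)) ⟩
  length (map _ (allFin r)) + length (map (U ∷_) (insertions w))
    ≡⟨ cong₂ _+_ (trans (length-map _ (allFin r)) (length-tabulate id))
                 (trans (length-map _ (insertions w)) (length-insertions w)) ⟩
  r + r * ups w
    ≡⟨ *-suc r (ups w) ⟨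
  r * suc (ups w) ∎
length-insertions (D c ∷ w) = trans (length-map _ (insertions w)) (length-insertions w)

⇝-dyckFrom : {w v : List (Step r)} → w ⇝ v → (h : ℕ) → dyckFrom h v ≡ dyckFrom h w
⇝-dyckFrom (here _ w)          h       = dyckFrom-U∷ h _
⇝-dyckFrom (there U {w} {v} p) h       =
  trans (dyckFrom-U∷ h v) (trans (⇝-dyckFrom p (suc h)) (sym (dyckFrom-U∷ h w)))
⇝-dyckFrom (there (D _) p)     zero    = refl
⇝-dyckFrom (there (D _) p)     (suc h) = ⇝-dyckFrom p h

noSameDD-U∷ : (w : List (Step r)) → noSameDD (U ∷ w) ≡ noSameDD w
noSameDD-U∷ []      = refl
noSameDD-U∷ (_ ∷ _) = refl

⇝-noSameDD : {w v : List (Step r)} → w ⇝ v → noSameDD v ≡ noSameDD w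
⇝-noSameDD (here _ _)                    = refl
⇝-noSameDD (there U {w} {v} p)           =
  trans (noSameDD-U∷ v) (trans (⇝-noSameDD p) (sym (noSameDD-U∷ w)))
⇝-noSameDD (there (D _) (here _ _))      = refl
⇝-noSameDD (there (D _) (there U p))     = ⇝-noSameDD (there U p)
⇝-noSameDD (there (D _) (there (D d) p)) = cong (_ ∧_) (⇝-noSameDD (there (D d) p))

⇝-inA : {w v : List (Step r)} → w ⇝ v → inA v ≡ inA w
⇝-inA p = cong₂ _∧_ (⇝-dyckFrom p 0) (⇝-noSameDD p)

∑-insertions-inA : (w : List (Step r)) → ∑[ v ∈ insertions w ] 𝟙 (inA v) ≡ r * ups w * 𝟙 (inA w)
∑-insertions-inA {r} w = begin
  ∑[ v ∈ insertions w ] 𝟙 (inA v)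
    ≡⟨ ∑-congᴬ (All.map (cong 𝟙 ∘ ⇝-inA) (insertions-⇝ w)) ⟩
  ∑[ _ ∈ insertions w ] 𝟙 (inA w)
    ≡⟨ ∑-const _ (insertions w) ⟩
  length (insertions w) * 𝟙 (inA w)
    ≡⟨ cong (_* 𝟙 (inA w)) (length-insertions w) ⟩
  r * ups w * 𝟙 (inA w) ∎

∑-countUDU-insertions : (k : ℕ) (g : List (Step r) → ℕ) →
  ∑[ v ∈ words r (2 + k) ] countUDU v * g v ≡ ∑[ w ∈ words r k ] ∑ (insertions w) g
∑-countUDU-insertions {r} zero g =
  trans (∑-congᴬ (All.map (λ {v} l → cong (_* g v) (n≤0⇒n≡0 (countUDU-≤ 0 v l))) (words-length 2)))
        (∑-zero (words r 2))
∑-countUDU-insertions {r} (suc k) g = begin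
  ∑[ v ∈ words r (3 + k) ] countUDU v * g v
    ≡⟨ ∑-words-suc (2 + k) _ ⟩
  ∑[ v ∈ words r (2 + k) ] countUDU (U ∷ v) * g (U ∷ v)
    + ∑[ c ∈ allFin r ] ∑[ v ∈ words r (2 + k) ] countUDU v * g (D c ∷ v)
    ≡⟨ cong₂ _+_ ups-part (∑-cong (allFin r) (λ c → ∑-countUDU-insertions k (g ∘ (D c ∷_)))) ⟩
  (∑[ c ∈ allFin r ] ∑[ w ∈ words r k ] g (U ∷ D c ∷ U ∷ w)
     + ∑[ w ∈ words r k ] ∑ (insertions w) (g ∘ (U ∷_)))
    + ∑[ c ∈ allFin r ] ∑[ w ∈ words r k ] ∑ (insertions w) (g ∘ (D c ∷_))
    ≡⟨ cong₂ _+_ (trans (cong₂ _+_ (∑-comm (λ c w → g (U ∷ D c ∷ U ∷ w)) (allFin r) (words r k)) refl)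
                        (sym (∑-+ (words r k))))
                 refl ⟩
  ∑[ w ∈ words r k ] (∑[ c ∈ allFin r ] g (U ∷ D c ∷ U ∷ w) + ∑ (insertions w) (g ∘ (U ∷_)))
    + ∑[ c ∈ allFin r ] ∑[ w ∈ words r k ] ∑ (insertions w) (g ∘ (D c ∷_))
    ≡⟨ cong₂ _+_ (∑-cong (words r k) (λ w → sym (∑-insertions-U∷ w)))
                 (∑-cong (allFin r) (λ c →
                   ∑-cong (words r k) (λ w → sym (∑-map (D c ∷_) (insertions w))))) ⟩
  ∑[ w ∈ words r k ] ∑ (insertions (U ∷ w)) g
    + ∑[ c ∈ allFin r ] ∑[ w ∈ words r k ] ∑ (insertions (D c ∷ w)) g
    ≡⟨ ∑-words-suc k _ ⟨
  ∑[ w ∈ words r (suc k) ] ∑ (insertions w) g ∎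
  where
  ∑-insertions-U∷ : (w : List (Step r)) →
    ∑ (insertions (U ∷ w)) g ≡ ∑[ c ∈ allFin r ] g (U ∷ D c ∷ U ∷ w) + ∑ (insertions w) (g ∘ (U ∷_))
  ∑-insertions-U∷ w = trans (∑-++ (map _ (allFin r)) _)
                            (cong₂ _+_ (∑-map _ (allFin r)) (∑-map (U ∷_) (insertions w)))

  ups-part : ∑[ v ∈ words r (2 + k) ] countUDU (U ∷ v) * g (U ∷ v) ≡
             ∑[ c ∈ allFin r ] ∑[ w ∈ words r k ] g (U ∷ D c ∷ U ∷ w)
               + ∑[ w ∈ words r k ] ∑ (insertions w) (g ∘ (U ∷_))
  ups-part = begin
    ∑[ v ∈ words r (2 + k) ] countUDU (U ∷ v) * g (U ∷ v)
      ≡⟨ ∑-cong (words r (2 + k)) (λ v → trans (cong (_* g (U ∷ v)) (countUDU-U∷ v))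
                             (*-distribʳ-+ (g (U ∷ v)) (beginsDU v) (countUDU v))) ⟩
    ∑[ v ∈ words r (2 + k) ] (beginsDU v * g (U ∷ v) + countUDU v * g (U ∷ v))
      ≡⟨ ∑-+ (words r (2 + k)) ⟩
    ∑[ v ∈ words r (2 + k) ] beginsDU v * g (U ∷ v) + ∑[ v ∈ words r (2 + k) ] countUDU v * g (U ∷ v)
      ≡⟨ cong₂ _+_ (∑-words-beginsDU k (g ∘ (U ∷_))) (∑-countUDU-insertions k (g ∘ (U ∷_))) ⟩
    ∑[ c ∈ allFin r ] ∑[ w ∈ words r k ] g (U ∷ D c ∷ U ∷ w)
      + ∑[ w ∈ words r k ] ∑ (insertions w) (g ∘ (U ∷_)) ∎

∑-A : (r n : ℕ) (f : List (Step r) → ℕ) → ∑ (A r n) f ≡ ∑[ w ∈ words r (2 * n) ] f w * 𝟙 (inA w)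
∑-A r n f = trans (∑-filter (λ w → inA w ≟ᵇ true) (words r (2 * n)))
                  (∑-cong (words r (2 * n)) (λ w → trans (cong (_* f w) (𝟙-does-≟-true (inA w)))
                                                         (*-comm _ (f w))))

S≡∑ : (r n : ℕ) → S r n ≡ ∑[ w ∈ words r (2 * n) ] 𝟙 (inA w)
S≡∑ r n = trans (length-filter≡∑ (λ w → inA w ≟ᵇ true) (words r (2 * n)))
                (∑-cong (words r (2 * n)) (𝟙-does-≟-true ∘ inA))

2*[n+1] : (n : ℕ) → 2 * (n + 1) ≡ 2 + 2 * n
2*[n+1] = solve-∀

A-countUDU-≤ : (r n : ℕ) → All (λ v → countUDU v ≤ n) (A r (n + 1))
A-countUDU-≤ r n =
  filter⁺ _ (All.map (λ {v} l → countUDU-≤ n v (trans l (2*[n+1] n))) (words-length (2 * (n + 1))))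

∑-ups-A : (r n : ℕ) → ∑[ w ∈ words r (2 * n) ] ups w * 𝟙 (inA w) ≡ n * S r n
∑-ups-A r n = begin
  ∑[ w ∈ words r (2 * n) ] ups w * 𝟙 (inA w)
    ≡⟨ ∑-congᴬ (All.map (λ {w} → ups-weighted n w) (words-length (2 * n))) ⟩
  ∑[ w ∈ words r (2 * n) ] n * 𝟙 (inA w)
    ≡⟨ ∑-*ˡ n (words r (2 * n)) ⟩
  n * (∑[ w ∈ words r (2 * n) ] 𝟙 (inA w))
    ≡⟨ cong (n *_) (S≡∑ r n) ⟨
  n * S r n ∎

theorem6p2 : (r n : ℕ) → 2 ≤ r → 1 ≤ n →
    sumFrom1 n (λ ℓ → ℓ * T r (n + 1) ℓ) ≡ r * n * S r n
theorem6p2 r n _ _ = begin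
  sumFrom1 n (λ ℓ → ℓ * T r (n + 1) ℓ)
    ≡⟨ sumFrom1-fibres n countUDU (A r (n + 1)) (A-countUDU-≤ r n) ⟩
  ∑ (A r (n + 1)) countUDU
    ≡⟨ ∑-A r (n + 1) countUDU ⟩
  ∑[ v ∈ words r (2 * (n + 1)) ] countUDU v * 𝟙 (inA v)
    ≡⟨ cong (λ k → ∑[ v ∈ words r k ] countUDU v * 𝟙 (inA v)) (2*[n+1] n) ⟩
  ∑[ v ∈ words r (2 + 2 * n) ] countUDU v * 𝟙 (inA v)
    ≡⟨ ∑-countUDU-insertions (2 * n) (𝟙 ∘ inA) ⟩
  ∑[ w ∈ words r (2 * n) ] ∑[ v ∈ insertions w ] 𝟙 (inA v)
    ≡⟨ ∑-cong (words r (2 * n)) (λ w → trans (∑-insertions-inA w) (*-assoc r (ups w) _)) ⟩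
  ∑[ w ∈ words r (2 * n) ] r * (ups w * 𝟙 (inA w))
    ≡⟨ ∑-*ˡ r (words r (2 * n)) ⟩
  r * (∑[ w ∈ words r (2 * n) ] ups w * 𝟙 (inA w))
    ≡⟨ cong (r *_) (∑-ups-A r n) ⟩
  r * (n * S r n)
    ≡⟨ *-assoc r n (S r n) ⟨
  r * n * S r n ∎
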